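{- Let $G$ be a p-game, $\sigma$ a t-skeleton on $G$ and $g$ a p-strategy on $G$ with $\sigma\propto g$. Then for all $smn\in g^{\mathrm{Even}}$ and $\tilde s\tilde m\in\sigma^{\mathrm{Odd}}$ with $sm\simeq_G\tilde s\tilde m$, there exists $\tilde s\tilde m\tilde n\in\sigma$ with $smn\simeq_G\tilde s\tilde m\tilde n$.
   Context: Moves are triples $(m,x,y)$, $x\in\{O,P\}$, $y\in\{Q,A\}$. A j-sequence is a finite sequence $s$ of moves with pointers $\mathcal J_s(i)<i$ ($0$ = initial); equality means same moves and pointers; $X^{\mathrm{Even}},X^{\mathrm{Odd}}$ denote even/odd-length elements. P-view $\lceil s\rceil$ and O-view $\lfloor s\rfloor$: $\lceil\epsilon\rceil=\epsilon$, $\lceil sm\rceil=\lceil s\rceil m$ ($m$ P-move), $\lceil sm\rceil=m$ ($m$ initial), $\lceil smtn\rceil=\lceil s\rceil mn$ ($n$ O-move justified by $m$); $\lfloor\epsilon\rfloor=\epsilon$, $\lfloor sm\rfloor=\lfloor s\rfloor m$ ($m$ O-move), $\lfloor smtn\rfloor=\lfloor s\rfloor mn$ ($n$ P-move justified by $m$). A legal position is a j-sequence with alternating O/P labels in which the justifier of each non-initial P-move (O-move) lies in the P-view (O-view) of the preceding prefix. A game is a pair $(P,\simeq)$ of a non-empty prefix-closed set of legal positions and an equivalence relation with (I1) $s\simeq t\Rightarrow|s|=|t|$, (I2) $sm\simeq tn\Rightarrow s\simeq t$ with $m,n$ of the same labels and equal pointers, (I3) $s\simeq t\wedge sm\in P\Rightarrow\exists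 tn\in P.\ sm\simeq tn$, whose induced arena (moves occurring, $\star\vdash m$ iff $m$ occurs initially, $m\vdash n$ iff $n$ occurs justified by $m$) has O-question initial moves, answers enabled only by questions, non-$\star$ enabling flipping O/P, and no infinite chain $\star\vdash m_0\vdash m_1\vdash\cdots$. Fix a countable set $\mathcal B\supseteq\{q,tt,ff\}\cup\mathbb N$. A standard move is a move $((m,\mathbf d,\mathbf e),x,y)$ with $m\in\mathcal B$, $\mathbf d\in\{0,1\}^*$, $\mathbf e\in(\mathbb N\times\{0,1\}^*)^*$; $\mathscr J(\mathscr M)$ is the set of j-sequences of standard moves. $s\simeq_{\mathscr U}t$ iff $s,t$ have the same length, labels, pointers and $(m,\mathbf d)$ components at each position, and there are permutations $\varphi_{\mathbf j}$ of $\mathbb N$, indexed by the binary words $\mathbf j$ occurring in the $\mathbf e$-components of $s$, such that each $\mathbf e$-component of $t(l)$ is obtained from that of $s(l)$ by replacing each $(i,\mathbf j)$ with $(\varphi_{\mathbf j}(i),\mathbf j)$. A game $(P,\simeq)$ is standard if its moves are standard, $\simeq\ =\ \simeq_{\mathscr U}\cap(P\times P)$, and $s\in\mathscr J(\mathscr M)$, $t\in P$, $s\simeq_{\mathscr U}t$ imply $s\in P$. A t-skeleton is a non-empty prefix-closed set $S$ of legal positions with $smn,smn'\in S^{\mathrm{Even}}\Rightarrow smn=smn'$ and well-founded induced arena; it is standard if $S\subseteq\mathscr J(\mathscr M)$ and $sm\in S$, $sm'\in\mathscr J(\mathscr M)^{\mathrm{Odd}}$, $sm\simeq_{\mathscr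 U}sm'$ imply $sm'\in S$. A non-empty set $\mathcal S$ of t-skeletons is consistent if the union of their induced arenas is well-founded and for $\sigma,\tau\in\mathcal S$, $sm\in(\sigma\cup\tau)^{\mathrm{Odd}}$, $s\in\sigma\cap\tau$ imply $sm\in\sigma\cap\tau$; $\sigma\asymp\tau$ means $\{\sigma,\tau\}$ is consistent. A p-game is a pair $G=(\mathcal{TS}(G),\simeq_G)$ of a non-empty set of standard t-skeletons and an equivalence relation on $P_G=\bigcup\mathcal{TS}(G)$ such that $(P_G,\simeq_G)$ is a standard game and: (det-j completeness) the union of any consistent deterministic subset of $\mathcal{TS}(G)$ lies in $\mathcal{TS}(G)$; (downward) if $\sigma\in\mathcal{TS}(G)$ and a standard t-skeleton $\tilde\sigma\subseteq P_G$ satisfies $\tilde\sigma\asymp\sigma$, $\tilde\sigma\subseteq\sigma$, then $\tilde\sigma\in\mathcal{TS}(G)$; (horizontal) if $\sigma\in\mathcal{TS}(G)$ and a standard t-skeleton $\tilde\sigma\subseteq P_G$ satisfies $\sigma\lesssim_G\tilde\sigma$ and $\tilde\sigma\lesssim_G\sigma$, then $\tilde\sigma\in\mathcal{TS}(G)$; here $\sigma\lesssim_G\tilde\sigma$ iff $\sigma\asymp\tilde\sigma$ and for all $smn\in\sigma^{\mathrm{Even}}$, $\tilde s\tilde m\in\tilde\sigma$ with $sm\simeq_G\tilde s\tilde m$ there is $\tilde s\tilde m\tilde n\in\tilde\sigma$ with $smn\simeq_G\tilde s\tilde m\tilde n$. A t-skeleton on $G$ is an element of $\mathcal{TS}(G)$.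 For $\sigma\in\mathcal{TS}(G)$ and $g\subseteq P_G$, $\sigma\propto g$ iff $\sigma\subseteq g$, $s\in\sigma\wedge sm\in g^{\mathrm{Odd}}\Rightarrow sm\in\sigma$, and for all $smn\in g$ with $s\in\sigma$ there is $smn'\in\sigma$ with $smn\simeq_G smn'$. A p-strategy on $G$ is a non-empty prefix-closed $g\subseteq P_G$ with $smn,tlr\in g^{\mathrm{Even}}\wedge sm\simeq_G tl\Rightarrow smn\simeq_G tlr$, with $s\in g\wedge t\in P_G\wedge s\simeq_G t\Rightarrow t\in g$, and such that $\sigma\propto g$ for some $\sigma\in\mathcal{TS}(G)$. -}

module Defs where

open import Level using (Level; _⊔_; 0ℓ) renaming (suc to lsuc)
open import Data.Nat using (ℕ; zero; suc; _+_; _≤_; _<_)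
open import Data.Bool using (Bool)
open import Data.List using (List; []; _∷_; _++_; _∷ʳ_; length; map; [_])
open import Data.List.Membership.Propositional using (_∈_)
open import Data.List.Relation.Binary.Pointwise using (Pointwise)
open import Data.Maybe using (Maybe; just; nothing)
open import Data.Product using (Σ; Σ-syntax; ∃; _×_; _,_; proj₁; proj₂)
open import Data.Sum using (_⊎_)
open import Data.Empty using (⊥)
open import Relation.Nullary using (¬_)
open import Relation.Binary.PropositionalEquality using (_≡_; _≢_)
open import Function.Bundles using (_↔_; Inverse)
open import Function.Definitions using (Injective)

Even : ℕ → Set
Even n = Σ[ k ∈ ℕ ] n ≡ k + k

Odd : ℕ → Set
Odd n = Σ[ k ∈ ℕ ] n ≡ suc (k + k)

-- at xs k : the k-th element, 1-indexed (position 0 never exists)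
at : {A : Set} → List A → ℕ → Maybe A
at xs zero = nothing
at [] (suc k) = nothing
at (x ∷ xs) (suc zero) = just x
at (x ∷ xs) (suc (suc k)) = at xs (suc k)

data OP : Set where
  O P : OP

data QA : Set where
  Q A : QA

module Generic (M : Set) where

  Move : Set
  Move = M × OP × QA

  opOf : Move → OP
  opOf (_ , x , _) = x

  qaOf : Move → QA
  qaOf (_ , _ , y) = y

  -- an occurrence: a move together with its pointer (0 = initial,
  -- k ≥ 1 = justified by the move at 1-indexed position k)
  Entry : Set
  Entry = Move × ℕ

  -- raw sequences; a j-sequence is one satisfying IsJSeq
  JSeq : Set
  JSeq = List Entry

  IsJSeq : JSeq → Set
  IsJSeq s = ∀ k e → at s (suc k) ≡ just e → proj₂ e < suc k

  -- P-view of the prefix of length k of s, as the list of positions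
  -- (occurrences) it consists of
  data PView (s : JSeq) : ℕ → List ℕ → Set where
    pv-ε    : PView s 0 []
    pv-P    : ∀ {k v m y j} → at s (suc k) ≡ just ((m , P , y) , j) →
              PView s k v → PView s (suc k) (v ∷ʳ suc k)
    pv-init : ∀ {k m y} → at s (suc k) ≡ just ((m , O , y) , 0) →
              PView s (suc k) [ suc k ]
    pv-O    : ∀ {k v n y j} → at s (suc k) ≡ just ((n , O , y) , suc j) →
              PView s j v → PView s (suc k) (v ∷ʳ suc j ∷ʳ suc k)

  data OView (s : JSeq) : ℕ → List ℕ → Set where
    ov-ε : OView s 0 []
    ov-O : ∀ {k v m y j} → at s (suc k) ≡ just ((m , O , y) , j) →
           OView s k v → OView s (suc k) (v ∷ʳ suc k)
    ov-P : ∀ {k v n y j} → at s (suc k) ≡ just ((n , P , y) , suc j) →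
           OView s j v → OView s (suc k) (v ∷ʳ suc j ∷ʳ suc k)

  Alternating : JSeq → Set
  Alternating s = ∀ k e₁ e₂ → at s k ≡ just e₁ → at s (suc k) ≡ just e₂ →
                  opOf (proj₁ e₁) ≢ opOf (proj₁ e₂)

  Justified : JSeq → Set
  Justified s = ∀ k m j → at s (suc k) ≡ just (m , suc j) →
    (opOf m ≡ P → Σ[ v ∈ List ℕ ] PView s k v × suc j ∈ v) ×
    (opOf m ≡ O → Σ[ v ∈ List ℕ ] OView s k v × suc j ∈ v)

  Legal : JSeq → Set
  Legal s = IsJSeq s × Alternating s × Justified s

  module _ {ℓ : Level} (S : JSeq → Set ℓ) where

    NonEmpty : Set ℓ
    NonEmpty = Σ[ s ∈ JSeq ] S s

    PrefixClosed : Set ℓ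
    PrefixClosed = ∀ s t → S (s ++ t) → S s

    AllLegal : Set ℓ
    AllLegal = ∀ s → S s → Legal s

    StarEnables : Move → Set ℓ
    StarEnables m = Σ[ s ∈ JSeq ] S s × Σ[ k ∈ ℕ ] at s k ≡ just (m , 0)

    Enables : Move → Move → Set ℓ
    Enables m n = Σ[ s ∈ JSeq ] S s × Σ[ k ∈ ℕ ] Σ[ j ∈ ℕ ] Σ[ p ∈ ℕ ]
      at s k ≡ just (n , j) × at s j ≡ just (m , p)

    WellFoundedArena : Set ℓ
    WellFoundedArena = ¬ (Σ[ f ∈ (ℕ → Move) ]
      StarEnables (f 0) × (∀ i → Enables (f i) (f (suc i))))

    GoodArena : Set ℓ
    GoodArena =
      (∀ m → StarEnables m → opOf m ≡ O × qaOf m ≡ Q) ×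
      (∀ m n → Enables m n → qaOf n ≡ A → qaOf m ≡ Q) ×
      (∀ m n → Enables m n → opOf m ≢ opOf n) ×
      WellFoundedArena

  record IsGame {ℓ ℓ'} (Pos : JSeq → Set ℓ) (_≃_ : JSeq → JSeq → Set ℓ')
         : Set (ℓ ⊔ ℓ') where
    field
      nonEmpty     : NonEmpty Pos
      prefixClosed : PrefixClosed Pos
      legal        : AllLegal Pos
      ≃-onPos      : ∀ {s t} → s ≃ t → Pos s × Pos t
      ≃-refl       : ∀ {s} → Pos s → s ≃ s
      ≃-sym        : ∀ {s t} → s ≃ t → t ≃ s
      ≃-trans      : ∀ {s t u} → s ≃ t → t ≃ u → s ≃ u
      I1 : ∀ {s t} → s ≃ t → length s ≡ length t
      I2 : ∀ {s t m n i j} → (s ∷ʳ (m , i)) ≃ (t ∷ʳ (n , j)) →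
           s ≃ t × opOf m ≡ opOf n × qaOf m ≡ qaOf n × i ≡ j
      I3 : ∀ {s t e} → s ≃ t → Pos (s ∷ʳ e) →
           Σ[ e' ∈ Entry ] Pos (t ∷ʳ e') × (s ∷ʳ e) ≃ (t ∷ʳ e')
      arena : GoodArena Pos

  module _ {ℓ : Level} (S : JSeq → Set ℓ) where

    PDeterministic : Set ℓ
    PDeterministic = ∀ s m n n' → Even (length (s ∷ʳ m ∷ʳ n)) →
      S (s ∷ʳ m ∷ʳ n) → S (s ∷ʳ m ∷ʳ n') → (s ∷ʳ m ∷ʳ n) ≡ (s ∷ʳ m ∷ʳ n')

    IsTSkeleton : Set ℓ
    IsTSkeleton = NonEmpty S × PrefixClosed S × AllLegal S ×
                  PDeterministic × WellFoundedArena S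

  ⋃ : {ℓ ℓ' : Level} → ((JSeq → Set ℓ) → Set ℓ') → JSeq → Set (lsuc ℓ ⊔ ℓ')
  ⋃ {ℓ} 𝒮 s = Σ[ σ ∈ (JSeq → Set ℓ) ] 𝒮 σ × σ s

  Consistent : {ℓ ℓ' : Level} → ((JSeq → Set ℓ) → Set ℓ') → Set (lsuc ℓ ⊔ ℓ')
  Consistent {ℓ} 𝒮 =
    (Σ[ σ ∈ (JSeq → Set ℓ) ] 𝒮 σ) ×
    -- the union of the induced arenas = arena induced by the union
    WellFoundedArena (⋃ 𝒮) ×
    (∀ σ τ → 𝒮 σ → 𝒮 τ → ∀ s e → Odd (length (s ∷ʳ e)) →
      (σ (s ∷ʳ e) ⊎ τ (s ∷ʳ e)) → σ s → τ s → σ (s ∷ʳ e) × τ (s ∷ʳ e))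

  _≍_ : {ℓ : Level} → (JSeq → Set ℓ) → (JSeq → Set ℓ) → Set (lsuc ℓ)
  _≍_ {ℓ} σ τ = Consistent {ℓ} {lsuc ℓ} (λ ρ → (ρ ≡ σ) ⊎ (ρ ≡ τ))

record BaseSet : Set₁ where
  field
    Carrier : Set
    q tt ff : Carrier
    num     : ℕ → Carrier
    num-inj : Injective _≡_ _≡_ num
    q≢tt    : q ≢ tt
    q≢ff    : q ≢ ff
    tt≢ff   : tt ≢ ff
    q∉ℕ     : ∀ n → num n ≢ q
    tt∉ℕ    : ∀ n → num n ≢ tt
    ff∉ℕ    : ∀ n → num n ≢ ff
    enc     : Carrier → ℕ
    enc-inj : Injective _≡_ _≡_ enc

module Std (𝓑 : BaseSet) where

  open BaseSet 𝓑 using (Carrier)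

  -- the content (m , d , e) of a standard move
  Inner : Set
  Inner = Carrier × List Bool × List (ℕ × List Bool)

  open Generic Inner public

  -- s ≃_U t.  The permutations φ_j are given for all binary words j;
  -- only those occurring in the e-components of s matter.
  _≃U_ : JSeq → JSeq → Set
  s ≃U t = Σ[ φ ∈ (List Bool → ℕ ↔ ℕ) ] Pointwise (R φ) s t
    where
    R : (List Bool → ℕ ↔ ℕ) → Entry → Entry → Set
    R φ (((m , d , e) , x , y) , p) (((m' , d' , e') , x' , y') , p') =
      m ≡ m' × d ≡ d' × x ≡ x' × y ≡ y' × p ≡ p' ×
      e' ≡ map (λ ij → Inverse.to (φ (proj₂ ij)) (proj₁ ij) , proj₂ ij) e

  record IsStandardGame {ℓ ℓ'} (Pos : JSeq → Set ℓ) (_≃_ : JSeq → JSeq → Set ℓ')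
         : Set (ℓ ⊔ ℓ') where
    field
      isGame : IsGame Pos _≃_
      ≃-is-≃U : ∀ s t → (s ≃ t → s ≃U t × Pos s × Pos t) ×
                        (s ≃U t × Pos s × Pos t → s ≃ t)
      ≃U-closed : ∀ s t → IsJSeq s → Pos t → s ≃U t → Pos s

  IsStdTSkeleton : {ℓ : Level} → (JSeq → Set ℓ) → Set ℓ
  IsStdTSkeleton S = IsTSkeleton S ×
    (∀ s → S s → IsJSeq s) ×
    (∀ s e e' → S (s ∷ʳ e) → IsJSeq (s ∷ʳ e') → Odd (length (s ∷ʳ e')) →
       (s ∷ʳ e) ≃U (s ∷ʳ e') → S (s ∷ʳ e'))

  DeterministicFamily : ((JSeq → Set) → Set) → Set₁
  DeterministicFamily 𝒮 = PDeterministic (⋃ 𝒮)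

  record PGame : Set₁ where
    field
      TS  : (JSeq → Set) → Set
      _≃_ : JSeq → JSeq → Set

    PG : JSeq → Set₁
    PG = ⋃ TS

    _⊆PG : (JSeq → Set) → Set₁
    σ ⊆PG = ∀ s → σ s → PG s

    _≲_ : (JSeq → Set) → (JSeq → Set) → Set₁
    σ ≲ σ̃ = (σ ≍ σ̃) ×
      (∀ s m n s̃ m̃ → Even (length (s ∷ʳ m ∷ʳ n)) → σ (s ∷ʳ m ∷ʳ n) →
         σ̃ (s̃ ∷ʳ m̃) → (s ∷ʳ m) ≃ (s̃ ∷ʳ m̃) →
         Σ[ ñ ∈ Entry ] σ̃ (s̃ ∷ʳ m̃ ∷ʳ ñ) × (s ∷ʳ m ∷ʳ n) ≃ (s̃ ∷ʳ m̃ ∷ʳ ñ))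

    field
      TS-nonEmpty : Σ[ σ ∈ (JSeq → Set) ] TS σ
      TS-std      : ∀ σ → TS σ → IsStdTSkeleton σ
      isStdGame   : IsStandardGame PG _≃_
      -- det-j completeness (membership of the union up to extensional equality)
      detJ : (𝒮 : (JSeq → Set) → Set) → (∀ σ → 𝒮 σ → TS σ) →
             Consistent 𝒮 → DeterministicFamily 𝒮 →
             Σ[ ρ ∈ (JSeq → Set) ] TS ρ ×
               (∀ s → (ρ s → ⋃ 𝒮 s) × (⋃ 𝒮 s → ρ s))
      downward : ∀ σ σ̃ → TS σ → IsStdTSkeleton σ̃ → σ̃ ⊆PG →
                 σ̃ ≍ σ → (∀ s → σ̃ s → σ s) → TS σ̃
      horizontal : ∀ σ σ̃ → TS σ → IsStdTSkeleton σ̃ → σ̃ ⊆PG →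
                   σ ≲ σ̃ → σ̃ ≲ σ → TS σ̃

  module _ (G : PGame) where
    open PGame G

    _∝_ : (JSeq → Set) → (JSeq → Set) → Set
    σ ∝ g = (∀ s → σ s → g s) ×
      (∀ s e → σ s → g (s ∷ʳ e) → Odd (length (s ∷ʳ e)) → σ (s ∷ʳ e)) ×
      (∀ s m n → g (s ∷ʳ m ∷ʳ n) → σ s →
         Σ[ n' ∈ Entry ] σ (s ∷ʳ m ∷ʳ n') × (s ∷ʳ m ∷ʳ n) ≃ (s ∷ʳ m ∷ʳ n'))

    IsPStrategy : (JSeq → Set) → Set₁
    IsPStrategy g =
      NonEmpty g × PrefixClosed g × g ⊆PG ×
      (∀ s m n t l r → Even (length (s ∷ʳ m ∷ʳ n)) → Even (length (t ∷ʳ l ∷ʳ r)) →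
         g (s ∷ʳ m ∷ʳ n) → g (t ∷ʳ l ∷ʳ r) → (s ∷ʳ m) ≃ (t ∷ʳ l) →
         (s ∷ʳ m ∷ʳ n) ≃ (t ∷ʳ l ∷ʳ r)) ×
      (∀ s t → g s → PG t → s ≃ t → g t) ×
      (Σ[ σ ∈ (JSeq → Set) ] TS σ × σ ∝ g)

module Submission where

open import Defs
open import Data.List using ([_]; _∷ʳ_; length)
open import Data.Product using (Σ-syntax; _×_; _,_)

-- Extend s̃m̃ by a move answering smn up to ≃ (axiom I3); since g is closed under ≃
-- this extension is a position of g, so σ ∝ g supplies σ's own answer at s̃m̃.

module _ {𝓑 : BaseSet} (G : Std.PGame 𝓑) where
  open Std 𝓑
  open PGame G
  open IsGame (IsStandardGame.isGame isStdGame) using (I3; ≃-trans) public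

  tSkeleton-prefix : ∀ {σ s e} → TS σ → σ (s ∷ʳ e) → σ s
  tSkeleton-prefix {σ} {s} {e} tsσ σse with TS-std σ tsσ
  ... | (_ , prefixClosed , _) , _ = prefixClosed s [ e ] σse

  pStrategy-transport : ∀ {g s m n t} → IsPStrategy G g →
    g (s ∷ʳ m ∷ʳ n) → (s ∷ʳ m) ≃ t →
    Σ[ n' ∈ Entry ] g (t ∷ʳ n') × (s ∷ʳ m ∷ʳ n) ≃ (t ∷ʳ n')
  pStrategy-transport (_ , _ , g⊆PG , _ , g-≃-closed , _) gsmn sm≃t
    with I3 sm≃t (g⊆PG _ gsmn)
  ... | n' , PGtn' , smn≃tn' = n' , g-≃-closed _ _ gsmn PGtn' smn≃tn' , smn≃tn'

mainTheorem10 : (𝓑 : BaseSet) → let open Std 𝓑 in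
    (G : PGame) → let open PGame G in
    (σ g : JSeq → Set) → TS σ → IsPStrategy G g → _∝_ G σ g →
    ∀ s m n → g (s ∷ʳ m ∷ʳ n) → Even (length (s ∷ʳ m ∷ʳ n)) →
    ∀ s̃ m̃ → σ (s̃ ∷ʳ m̃) → Odd (length (s̃ ∷ʳ m̃)) → (s ∷ʳ m) ≃ (s̃ ∷ʳ m̃) →
    Σ[ ñ ∈ Entry ] σ (s̃ ∷ʳ m̃ ∷ʳ ñ) × (s ∷ʳ m ∷ʳ n) ≃ (s̃ ∷ʳ m̃ ∷ʳ ñ)
mainTheorem10 𝓑 G σ g tsσ isStrat (_ , _ , σ-answers) s m n gsmn _ s̃ m̃ σs̃m̃ _ sm≃s̃m̃
  with pStrategy-transport G isStrat gsmn sm≃s̃m̃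
... | e , gs̃m̃e , smn≃s̃m̃e
  with σ-answers s̃ m̃ e gs̃m̃e (tSkeleton-prefix G tsσ σs̃m̃)
... | ñ , σs̃m̃ñ , s̃m̃e≃s̃m̃ñ = ñ , σs̃m̃ñ , ≃-trans G smn≃s̃m̃e s̃m̃e≃s̃m̃ñ
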